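{- Let $(R_i)_{i\in I}$ be a family of commutative rings with $\mathrm{Pic}(\operatorname{Spec}R_i)=0$ for every $i\in I$. Then $\mathrm{Pic}\big(\operatorname{Spec}\prod_{i\in I}R_i\big)=0$. -}

module Defs where

open import Level using (Level; _⊔_; suc; Setω)
open import Data.Product using (Σ; _×_; _,_; proj₁; proj₂)
open import Algebra.Bundles using (CommutativeRing)
open import Algebra.Module.Bundles using (Module)
open import Algebra.Module.Construct.TensorUnit using (⟨module⟩)
open import Algebra.Module.Morphism.Structures using (module ModuleMorphisms)

module _ {a c ℓ : Level} (I : Set a) (R : I → CommutativeRing c ℓ) where
  private
    module R i = CommutativeRing (R i)

  ΠRing : CommutativeRing (a ⊔ c) (a ⊔ ℓ)
  ΠRing = record
    { Carrier = (i : I) → R.Carrier i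
    ; _≈_ = λ f g → (i : I) → R._≈_ i (f i) (g i)
    ; _+_ = λ f g i → R._+_ i (f i) (g i)
    ; _*_ = λ f g i → R._*_ i (f i) (g i)
    ; -_  = λ f i → R.-_ i (f i)
    ; 0#  = λ i → R.0# i
    ; 1#  = λ i → R.1# i
    ; isCommutativeRing = record
      { isRing = record
        { +-isAbelianGroup = record
          { isGroup = record
            { isMonoid = record
              { isSemigroup = record
                { isMagma = record
                  { isEquivalence = record
                    { refl  = λ i → R.refl i
                    ; sym   = λ p i → R.sym i (p i)
                    ; trans = λ p q i → R.trans i (p i) (q i)
                    }
                  ; ∙-cong = λ p q i → R.+-cong i (p i) (q i)
                  }
                ; assoc = λ f g h i → R.+-assoc i (f i) (g i) (h i)
                }
              ; identity = (λ f i → R.+-identityˡ i (f i))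
                         , (λ f i → R.+-identityʳ i (f i))
              }
            ; inverse = (λ f i → R.-‿inverseˡ i (f i))
                      , (λ f i → R.-‿inverseʳ i (f i))
            ; ⁻¹-cong = λ p i → R.-‿cong i (p i)
            }
          ; comm = λ f g i → R.+-comm i (f i) (g i)
          }
        ; *-cong = λ p q i → R.*-cong i (p i) (q i)
        ; *-assoc = λ f g h i → R.*-assoc i (f i) (g i) (h i)
        ; *-identity = (λ f i → R.*-identityˡ i (f i))
                     , (λ f i → R.*-identityʳ i (f i))
        ; distrib = (λ f g h i → R.distribˡ i (f i) (g i) (h i))
                  , (λ f g h i → R.distribʳ i (f i) (g i) (h i))
        }
      ; *-comm = λ f g i → R.*-comm i (f i) (g i)
      }
    }

module _ {c ℓ : Level} (A : CommutativeRing c ℓ) where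
  open CommutativeRing A using (Carrier)

  regular : Module A c ℓ
  regular = ⟨module⟩

  record IsBilinear {m ℓm n ℓn p ℓp : Level}
           (M : Module A m ℓm) (N : Module A n ℓn) (P : Module A p ℓp)
           (β : Module.Carrierᴹ M → Module.Carrierᴹ N → Module.Carrierᴹ P)
           : Set (c ⊔ m ⊔ ℓm ⊔ n ⊔ ℓn ⊔ ℓp) where
    private
      module M = Module M
      module N = Module N
      module P = Module P
    field
      cong  : ∀ {x x′ y y′} → x M.≈ᴹ x′ → y N.≈ᴹ y′ → β x y P.≈ᴹ β x′ y′
      +-homoˡ : ∀ x x′ y → β (x M.+ᴹ x′) y P.≈ᴹ (β x y P.+ᴹ β x′ y)
      +-homoʳ : ∀ x y y′ → β x (y N.+ᴹ y′) P.≈ᴹ (β x y P.+ᴹ β x y′)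
      *-homoˡ : ∀ (r : Carrier) x y → β (r M.*ₗ x) y P.≈ᴹ (r P.*ₗ β x y)
      *-homoʳ : ∀ (r : Carrier) x y → β x (r N.*ₗ y) P.≈ᴹ (r P.*ₗ β x y)

  IsLinear : {m ℓm p ℓp : Level} (M : Module A m ℓm) (P : Module A p ℓp) →
             (Module.Carrierᴹ M → Module.Carrierᴹ P) → Set (c ⊔ m ⊔ ℓm ⊔ ℓp)
  IsLinear M P f =
    ModuleMorphisms.IsModuleHomomorphism (Module.rawModule M) (Module.rawModule P) f

  _≅ᴹ_ : {m ℓm p ℓp : Level} (M : Module A m ℓm) (P : Module A p ℓp) →
         Set (c ⊔ m ⊔ p ⊔ ℓm ⊔ ℓp)
  M ≅ᴹ P = Σ (Module.Carrierᴹ M → Module.Carrierᴹ P) λ f →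
    ModuleMorphisms.IsModuleIsomorphism (Module.rawModule M) (Module.rawModule P) f

  -- M ⊗_A N ≅ A, expressed via the universal property of the tensor
  -- product: there is a bilinear map β : M × N → A through which every
  -- bilinear map b : M × N → P factors via a unique linear map A → P.
  -- P ranges over modules at the level where the tensor product
  -- M ⊗_A N itself is constructed.
  TensorIsUnit : {m ℓm n ℓn : Level} (M : Module A m ℓm) (N : Module A n ℓn) →
                 Set (suc (c ⊔ ℓ ⊔ m ⊔ ℓm ⊔ n ⊔ ℓn))
  TensorIsUnit {m} {ℓm} {n} {ℓn} M N =
    Σ (Module.Carrierᴹ M → Module.Carrierᴹ N → Carrier) λ β →
      IsBilinear M N regular β ×
      ((P : Module A (c ⊔ ℓ ⊔ m ⊔ ℓm ⊔ n ⊔ ℓn) (c ⊔ ℓ ⊔ m ⊔ ℓm ⊔ n ⊔ ℓn)) →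
       (b : Module.Carrierᴹ M → Module.Carrierᴹ N → Module.Carrierᴹ P) →
       IsBilinear M N P b →
       Σ (Carrier → Module.Carrierᴹ P) λ f →
         IsLinear regular P f ×
         (∀ x y → Module._≈ᴹ_ P (f (β x y)) (b x y)) ×
         ((g : Carrier → Module.Carrierᴹ P) → IsLinear regular P g →
          (∀ x y → Module._≈ᴹ_ P (g (β x y)) (b x y)) →
          ∀ r → Module._≈ᴹ_ P (g r) (f r)))

  IsInvertibleWith : {m ℓm n ℓn : Level} (M : Module A m ℓm) (N : Module A n ℓn) →
                     Set (suc (c ⊔ ℓ ⊔ m ⊔ ℓm ⊔ n ⊔ ℓn))
  IsInvertibleWith M N = TensorIsUnit M N

  -- Pic(Spec A) = 0 : every invertible A-module is isomorphic to A.
  -- (Quantified over all universe levels, hence a Setω.)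
  PicTrivial : Setω
  PicTrivial = ∀ {m ℓm n ℓn : Level} (M : Module A m ℓm) (N : Module A n ℓn) →
               IsInvertibleWith M N → M ≅ᴹ regular

{-# OPTIONS --safe #-}

-- Let A = Π Rᵢ and let β : M × N → A exhibit M ⊗ N ≅ A.  Comparing the quotient map and the
-- zero map A → A/im β shows 1 = Σₖ β xₖ yₖ, and then x = Σₖ β x yₖ · swap xₖ for every x, where
-- β x y · swap x′ = β x′ y · x: M is finitely generated projective and β is nondegenerate.
-- Base change along each projection A → Rᵢ keeps M invertible, so by hypothesis there are
-- isomorphisms φᵢ : Rᵢ ⊗ M ≅ Rᵢ; let φᵢ gᵢ = 1.  The dual-basis coefficients of all the gᵢ together
-- form elements of A, so they glue to one x₀ ∈ M, and x ↦ (φᵢ (1 ⊗ x))ᵢ is an isomorphism M ≅ A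
-- taking x₀ to 1.

module Submission where

open import Level using (Level; _⊔_; Lift; lift; lower)
open import Function using (flip; _∘_)
open import Data.Product using (Σ; _×_; _,_; proj₁; proj₂)
open import Data.List using (List; []; _∷_; _++_; map)
open import Data.Unit using (⊤)
open import Relation.Binary.Structures using (IsEquivalence)
open import Algebra.Bundles using (AbelianGroup; CommutativeRing; Ring)
open import Algebra.Module.Bundles using (Module)
open import Algebra.Module.Structures.Biased using (IsModuleFromLeft)
open import Algebra.Module.Morphism.Structures using (module ModuleMorphisms)
open import Algebra.Morphism.Structures using (module RingMorphisms)
import Algebra.Properties.AbelianGroup as AbelianGroupProperties
import Algebra.Properties.Group as GroupProperties
import Algebra.Properties.RingWithoutOne as RingWithoutOneProperties
import Algebra.Properties.CommutativeSemigroup as CommutativeSemigroupProperties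
import Relation.Binary.Reasoning.Setoid as SetoidReasoning
open import Defs

module _ {k ℓk : Level} (K : CommutativeRing k ℓk) where
  open CommutativeRing K using (_≈_; _+_; _*_; 0#; 1#) renaming (Carrier to K₀)

  moduleFromLeft : ∀ {x ℓx} {X : Set x} (_≈ᴹ_ : X → X → Set ℓx) (_+ᴹ_ : X → X → X) (0ᴹ : X)
    (-ᴹ_ : X → X) (_*ₗ_ : K₀ → X → X) →
    IsEquivalence _≈ᴹ_ →
    (∀ {a b c d} → a ≈ᴹ b → c ≈ᴹ d → (a +ᴹ c) ≈ᴹ (b +ᴹ d)) →
    (∀ a b c → ((a +ᴹ b) +ᴹ c) ≈ᴹ (a +ᴹ (b +ᴹ c))) →
    (∀ a b → (a +ᴹ b) ≈ᴹ (b +ᴹ a)) →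
    (∀ a → (0ᴹ +ᴹ a) ≈ᴹ a) →
    (∀ {a b} → a ≈ᴹ b → (-ᴹ a) ≈ᴹ (-ᴹ b)) →
    (∀ a → ((-ᴹ a) +ᴹ a) ≈ᴹ 0ᴹ) →
    (∀ {r s a b} → r ≈ s → a ≈ᴹ b → (r *ₗ a) ≈ᴹ (s *ₗ b)) →
    (∀ a → (0# *ₗ a) ≈ᴹ 0ᴹ) →
    (∀ a r s → ((r + s) *ₗ a) ≈ᴹ ((r *ₗ a) +ᴹ (s *ₗ a))) →
    (∀ a → (1# *ₗ a) ≈ᴹ a) →
    (∀ r s a → ((r * s) *ₗ a) ≈ᴹ (r *ₗ (s *ₗ a))) →
    (∀ r → (r *ₗ 0ᴹ) ≈ᴹ 0ᴹ) →
    (∀ r a b → (r *ₗ (a +ᴹ b)) ≈ᴹ ((r *ₗ a) +ᴹ (r *ₗ b))) →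
    Module K x ℓx
  moduleFromLeft {X = X} _≈ᴹ_ _+ᴹ_ 0ᴹ -ᴹ_ _*ₗ_ isEquivalence +ᴹ-cong +ᴹ-assoc +ᴹ-comm +ᴹ-identityˡ
    -ᴹ‿cong -ᴹ‿inverseˡ *ₗ-cong *ₗ-zeroˡ *ₗ-distribʳ *ₗ-identityˡ *ₗ-assoc *ₗ-zeroʳ *ₗ-distribˡ = record
    { Carrierᴹ = X ; _≈ᴹ_ = _≈ᴹ_ ; _+ᴹ_ = _+ᴹ_ ; _*ₗ_ = _*ₗ_ ; _*ᵣ_ = flip _*ₗ_ ; 0ᴹ = 0ᴹ ; -ᴹ_ = -ᴹ_
    ; isModule = IsModuleFromLeft.isModule {commutativeRing = K} (record { isLeftModule = record
        { isLeftSemimodule = record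
          { +ᴹ-isCommutativeMonoid = record
            { isMonoid = record
              { isSemigroup = record
                { isMagma = record { isEquivalence = isEquivalence ; ∙-cong = +ᴹ-cong }
                ; assoc = +ᴹ-assoc }
              ; identity = +ᴹ-identityˡ , (λ a → trans (+ᴹ-comm a 0ᴹ) (+ᴹ-identityˡ a)) }
            ; comm = +ᴹ-comm }
          ; isPreleftSemimodule = record
            { *ₗ-cong = *ₗ-cong ; *ₗ-zeroˡ = *ₗ-zeroˡ ; *ₗ-distribʳ = *ₗ-distribʳ
            ; *ₗ-identityˡ = *ₗ-identityˡ ; *ₗ-assoc = *ₗ-assoc ; *ₗ-zeroʳ = *ₗ-zeroʳ
            ; *ₗ-distribˡ = *ₗ-distribˡ } }
        ; -ᴹ‿cong = -ᴹ‿cong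
        ; -ᴹ‿inverse = -ᴹ‿inverseˡ , (λ a → trans (+ᴹ-comm a (-ᴹ a)) (-ᴹ‿inverseˡ a)) } }) }
    where open IsEquivalence isEquivalence

  module _ {m ℓm p ℓp : Level} (M : Module K m ℓm) (P : Module K p ℓp) where
    private
      module M = Module M
      module P = Module P

    mkIsLinear : (f : M.Carrierᴹ → P.Carrierᴹ) →
      (∀ {x y} → x M.≈ᴹ y → f x P.≈ᴹ f y) →
      (∀ x y → f (x M.+ᴹ y) P.≈ᴹ (f x P.+ᴹ f y)) →
      (∀ r x → f (r M.*ₗ x) P.≈ᴹ (r P.*ₗ f x)) →
      IsLinear K M P f
    mkIsLinear f cong +-homo *ₗ-homo = record { isBimoduleHomomorphism = record
      { +ᴹ-isGroupHomomorphism = record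
        { isMonoidHomomorphism = record
          { isMagmaHomomorphism = record { isRelHomomorphism = record { cong = cong } ; homo = +-homo }
          ; ε-homo = 0ᴹ-homo }
        ; ⁻¹-homo = -ᴹ-homo }
      ; *ₗ-homo = *ₗ-homo
      ; *ᵣ-homo = λ r x → P.≈ᴹ-trans (cong (M.≈ᴹ-sym (M.*ₗ-*ᵣ-coincident r x)))
                          (P.≈ᴹ-trans (*ₗ-homo r x) (P.*ₗ-*ᵣ-coincident r (f x))) } }
      where
      0ᴹ-homo : f M.0ᴹ P.≈ᴹ P.0ᴹ
      0ᴹ-homo = P.≈ᴹ-trans (cong (M.≈ᴹ-sym (M.*ₗ-zeroˡ M.0ᴹ)))
                  (P.≈ᴹ-trans (*ₗ-homo 0# M.0ᴹ) (P.*ₗ-zeroˡ (f M.0ᴹ)))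
      -ᴹ-homo : ∀ x → f (M.-ᴹ x) P.≈ᴹ (P.-ᴹ f x)
      -ᴹ-homo x = GroupProperties.inverseˡ-unique P.+ᴹ-group (f (M.-ᴹ x)) (f x)
        (P.≈ᴹ-trans (P.≈ᴹ-sym (+-homo (M.-ᴹ x) x)) (P.≈ᴹ-trans (cong (M.-ᴹ‿inverseˡ x)) 0ᴹ-homo))

  module _ {p ℓp : Level} (P : Module K p ℓp) {f : K₀ → Module.Carrierᴹ P}
           (f-linear : IsLinear K (regular K) P f) where
    open Module P
    open ModuleMorphisms.IsModuleHomomorphism f-linear

    linear-regular : ∀ r → f r ≈ᴹ (r *ₗ f 1#)
    linear-regular r = ≈ᴹ-trans (⟦⟧-cong (CommutativeRing.sym K (CommutativeRing.*-identityʳ K r)))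
                                (*ₗ-homo r 1#)

module ListSum {g ℓg : Level} (G : AbelianGroup g ℓg) where
  open AbelianGroup G

  ∑ : ∀ {z} {Z : Set z} → (Z → Carrier) → List Z → Carrier
  ∑ f []       = ε
  ∑ f (p ∷ ps) = f p ∙ ∑ f ps

  module _ {z} {Z : Set z} where
    ∑-cong : {f h : Z → Carrier} → (∀ p → f p ≈ h p) → ∀ ps → ∑ f ps ≈ ∑ h ps
    ∑-cong f≈h []       = refl
    ∑-cong f≈h (p ∷ ps) = ∙-cong (f≈h p) (∑-cong f≈h ps)

    ∑-++ : (f : Z → Carrier) → ∀ ps qs → ∑ f (ps ++ qs) ≈ ∑ f ps ∙ ∑ f qs
    ∑-++ f []       qs = sym (identityˡ _)
    ∑-++ f (p ∷ ps) qs = trans (∙-cong refl (∑-++ f ps qs)) (sym (assoc _ _ _))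

    ∑-map : ∀ {y} {Y : Set y} (f : Z → Carrier) (h : Y → Z) ps → ∑ f (map h ps) ≈ ∑ (f ∘ h) ps
    ∑-map f h []       = refl
    ∑-map f h (p ∷ ps) = ∙-cong refl (∑-map f h ps)

    ∑-distrib-∙ : (f h : Z → Carrier) → ∀ ps → ∑ (λ p → f p ∙ h p) ps ≈ ∑ f ps ∙ ∑ h ps
    ∑-distrib-∙ f h []       = sym (identityˡ ε)
    ∑-distrib-∙ f h (p ∷ ps) = trans (∙-cong refl (∑-distrib-∙ f h ps)) (interchange _ _ _ _)
      where open CommutativeSemigroupProperties commutativeSemigroup using (interchange)

    ∑-ε : ∀ ps → ∑ {Z = Z} (λ _ → ε) ps ≈ ε
    ∑-ε []       = refl
    ∑-ε (p ∷ ps) = trans (identityˡ _) (∑-ε ps)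

  ∑-comm : ∀ {w z} {W : Set w} {Z : Set z} (f : Z → W → Carrier) ps qs →
           ∑ (λ p → ∑ (f p) qs) ps ≈ ∑ (λ q → ∑ (λ p → f p q) ps) qs
  ∑-comm f []       qs = sym (∑-ε qs)
  ∑-comm f (p ∷ ps) qs =
    trans (∙-cong refl (∑-comm f ps qs)) (sym (∑-distrib-∙ (f p) (λ q → ∑ (λ p′ → f p′ q) ps) qs))

module _ {g ℓg h ℓh : Level} (G : AbelianGroup g ℓg) (H : AbelianGroup h ℓh) where
  private
    module G = AbelianGroup G
    module H = AbelianGroup H
  open ListSum

  ∑-homo : (f : G.Carrier → H.Carrier) → (∀ a b → f (a G.∙ b) H.≈ f a H.∙ f b) → f G.ε H.≈ H.ε →
           ∀ {z} {Z : Set z} (u : Z → G.Carrier) ps → f (∑ G u ps) H.≈ ∑ H (f ∘ u) ps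
  ∑-homo f ∙-homo ε-homo u []       = ε-homo
  ∑-homo f ∙-homo ε-homo u (p ∷ ps) =
    H.trans (∙-homo (u p) (∑ G u ps)) (H.∙-cong H.refl (∑-homo f ∙-homo ε-homo u ps))

module FormalCombination {k ℓk : Level} (K : CommutativeRing k ℓk) where
  open CommutativeRing K
  open ListSum +-abelianGroup public
  open RingWithoutOneProperties (Ring.ringWithoutOne ring) using (-‿distribˡ-*)
  open CommutativeSemigroupProperties *-commutativeSemigroup using () renaming (x∙yz≈y∙xz to *-lcomm)

  *-∑ : ∀ {z} {Z : Set z} (t : Carrier) (f : Z → Carrier) ps → t * ∑ f ps ≈ ∑ (λ p → t * f p) ps
  *-∑ t = ∑-homo +-abelianGroup +-abelianGroup (t *_) (distribˡ t) (zeroʳ t)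

  -‿∑ : ∀ {z} {Z : Set z} (f : Z → Carrier) ps → - ∑ f ps ≈ ∑ (λ p → - f p) ps
  -‿∑ = ∑-homo +-abelianGroup +-abelianGroup -_ -‿+-homo (GroupProperties.ε⁻¹≈ε +-group)
    where
    -‿+-homo : ∀ a b → - (a + b) ≈ - a + - b
    -‿+-homo a b = sym (AbelianGroupProperties.⁻¹-∙-comm +-abelianGroup a b)

  module _ {z} {Z : Set z} where
    negateCoeffs : List (Carrier × Z) → List (Carrier × Z)
    negateCoeffs = map (λ (r , x) → (- r , x))

    scaleCoeffs : Carrier → List (Carrier × Z) → List (Carrier × Z)
    scaleCoeffs t = map (λ (r , x) → (t * r , x))

    evaluate : (Z → Carrier) → List (Carrier × Z) → Carrier
    evaluate f = ∑ (λ (r , x) → r * f x)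

    evaluate-cong : {f h : Z → Carrier} → (∀ x → f x ≈ h x) → ∀ u → evaluate f u ≈ evaluate h u
    evaluate-cong f≈h = ∑-cong (λ (r , x) → *-cong refl (f≈h x))

    evaluate-++ : (f : Z → Carrier) → ∀ u v → evaluate f (u ++ v) ≈ evaluate f u + evaluate f v
    evaluate-++ f = ∑-++ _

    evaluate-negateCoeffs : (f : Z → Carrier) → ∀ u → evaluate f (negateCoeffs u) ≈ - evaluate f u
    evaluate-negateCoeffs f u = begin
      evaluate f (negateCoeffs u)          ≈⟨ ∑-map _ _ u ⟩
      ∑ (λ (r , x) → - r * f x) u          ≈⟨ ∑-cong (λ (r , x) → sym (-‿distribˡ-* r (f x))) u ⟩
      ∑ (λ (r , x) → - (r * f x)) u        ≈⟨ -‿∑ _ u ⟨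
      - evaluate f u                       ∎
      where open SetoidReasoning setoid

    evaluate-scaleCoeffs : (t : Carrier) (f : Z → Carrier) → ∀ u →
                           evaluate f (scaleCoeffs t u) ≈ t * evaluate f u
    evaluate-scaleCoeffs t f u = trans (∑-map _ _ u)
      (trans (∑-cong (λ _ → *-assoc _ _ _) u) (sym (*-∑ t _ u)))

    evaluate-+ : (f h : Z → Carrier) → ∀ u → evaluate (λ x → f x + h x) u ≈ evaluate f u + evaluate h u
    evaluate-+ f h u = trans (∑-cong (λ _ → distribˡ _ _ _) u) (∑-distrib-∙ _ _ u)

    evaluate-* : (t : Carrier) (f : Z → Carrier) → ∀ u → evaluate (λ x → t * f x) u ≈ t * evaluate f u
    evaluate-* t f u = trans (∑-cong (λ _ → *-lcomm _ _ _) u) (sym (*-∑ t _ u))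

  ∑-* : ∀ {z} {Z : Set z} (f : Z → Carrier) (t : Carrier) ps → ∑ f ps * t ≈ ∑ (λ p → f p * t) ps
  ∑-* f t = ∑-homo +-abelianGroup +-abelianGroup (_* t) (λ a b → distribʳ t a b) (zeroˡ t) f

  evaluate-comm : ∀ {y z} {Y : Set y} {Z : Set z} (f : Y → Z → Carrier) u v →
                  evaluate (λ x → evaluate (f x) v) u ≈ evaluate (λ w → evaluate (flip f w) u) v
  evaluate-comm f u v = begin
    ∑ (λ (r , x) → r * ∑ (λ (s , w) → s * f x w) v) u        ≈⟨ ∑-cong (λ (r , x) → *-∑ r _ v) u ⟩
    ∑ (λ (r , x) → ∑ (λ (s , w) → r * (s * f x w)) v) u      ≈⟨ ∑-comm _ u v ⟩
    ∑ (λ (s , w) → ∑ (λ (r , x) → r * (s * f x w)) u) v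
      ≈⟨ ∑-cong (λ (s , w) → ∑-cong (λ (r , x) → *-lcomm r s (f x w)) u) v ⟩
    ∑ (λ (s , w) → ∑ (λ (r , x) → s * (r * f x w)) u) v      ≈⟨ ∑-cong (λ (s , w) → *-∑ s _ u) v ⟨
    ∑ (λ (s , w) → s * ∑ (λ (r , x) → r * f x w) u) v        ∎
    where open SetoidReasoning setoid

  evaluate-∑ : ∀ {w z} {W : Set w} {Z : Set z} (f : Z → W → Carrier) (c : W → Carrier) u ws →
               evaluate (λ x → ∑ (λ q → f x q * c q) ws) u ≈ ∑ (λ q → evaluate (flip f q) u * c q) ws
  evaluate-∑ f c u ws = begin
    ∑ (λ (r , x) → r * ∑ (λ q → f x q * c q) ws) u        ≈⟨ ∑-cong (λ (r , x) → *-∑ r _ ws) u ⟩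
    ∑ (λ (r , x) → ∑ (λ q → r * (f x q * c q)) ws) u      ≈⟨ ∑-comm _ u ws ⟩
    ∑ (λ q → ∑ (λ (r , x) → r * (f x q * c q)) u) ws
      ≈⟨ ∑-cong (λ q → ∑-cong (λ (r , x) → sym (*-assoc r (f x q) (c q))) u) ws ⟩
    ∑ (λ q → ∑ (λ (r , x) → r * f x q * c q) u) ws        ≈⟨ ∑-cong (λ q → ∑-* _ (c q) u) ws ⟨
    ∑ (λ q → ∑ (λ (r , x) → r * f x q) u * c q) ws        ∎
    where open SetoidReasoning setoid

module Induced {k ℓk : Level} (K : CommutativeRing k ℓk) {t ℓt : Level} (T : Module K t ℓt)
  {x y : Level} (ℓ′ : Level) {Y : Set y} {X : Set x}
  (_+_ : X → X → X) (0ˣ : X) (-_ : X → X) (_·_ : CommutativeRing.Carrier K → X → X)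
  (e : X → Y → Module.Carrierᴹ T)
  (e-+ : ∀ u v w → Module._≈ᴹ_ T (e (u + v) w) (Module._+ᴹ_ T (e u w) (e v w)))
  (e-0 : ∀ w → Module._≈ᴹ_ T (e 0ˣ w) (Module.0ᴹ T))
  (e-- : ∀ u w → Module._≈ᴹ_ T (e (- u) w) (Module.-ᴹ_ T (e u w)))
  (e-· : ∀ r u w → Module._≈ᴹ_ T (e (r · u) w) (Module._*ₗ_ T r (e u w)))
  where
  open Module T
  private
    module K = CommutativeRing K
    infixr 4 _⟫_
    _⟫_ : ∀ {a b c} → a ≈ᴹ b → b ≈ᴹ c → a ≈ᴹ c
    _⟫_ = ≈ᴹ-trans

  _≈_ : X → X → Set (ℓ′ ⊔ y ⊔ ℓt)
  u ≈ v = Lift ℓ′ (∀ w → e u w ≈ᴹ e v w)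

  inducedModule : Module K x (ℓ′ ⊔ y ⊔ ℓt)
  inducedModule = moduleFromLeft K _≈_ _+_ 0ˣ -_ _·_
    (record { refl  = lift λ w → ≈ᴹ-refl
            ; sym   = λ p → lift λ w → ≈ᴹ-sym (lower p w)
            ; trans = λ p q → lift λ w → lower p w ⟫ lower q w })
    (λ p q → lift λ w → e-+ _ _ w ⟫ +ᴹ-cong (lower p w) (lower q w) ⟫ ≈ᴹ-sym (e-+ _ _ w))
    (λ a b c → lift λ w → e-+ _ _ w ⟫ +ᴹ-cong (e-+ _ _ w) ≈ᴹ-refl ⟫ +ᴹ-assoc _ _ _
                          ⟫ ≈ᴹ-sym (e-+ _ _ w ⟫ +ᴹ-cong ≈ᴹ-refl (e-+ _ _ w)))
    (λ a b → lift λ w → e-+ _ _ w ⟫ +ᴹ-comm _ _ ⟫ ≈ᴹ-sym (e-+ _ _ w))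
    (λ a → lift λ w → e-+ _ _ w ⟫ +ᴹ-cong (e-0 w) ≈ᴹ-refl ⟫ +ᴹ-identityˡ _)
    (λ p → lift λ w → e-- _ w ⟫ -ᴹ‿cong (lower p w) ⟫ ≈ᴹ-sym (e-- _ w))
    (λ a → lift λ w → e-+ _ _ w ⟫ +ᴹ-cong (e-- _ w) ≈ᴹ-refl ⟫ -ᴹ‿inverseˡ _ ⟫ ≈ᴹ-sym (e-0 w))
    (λ p q → lift λ w → e-· _ _ w ⟫ *ₗ-cong p (lower q w) ⟫ ≈ᴹ-sym (e-· _ _ w))
    (λ a → lift λ w → e-· _ _ w ⟫ *ₗ-zeroˡ _ ⟫ ≈ᴹ-sym (e-0 w))
    (λ a r s → lift λ w → e-· _ _ w ⟫ *ₗ-distribʳ _ _ _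
                          ⟫ ≈ᴹ-sym (e-+ _ _ w ⟫ +ᴹ-cong (e-· _ _ w) (e-· _ _ w)))
    (λ a → lift λ w → e-· _ _ w ⟫ *ₗ-identityˡ _)
    (λ r s a → lift λ w → e-· _ _ w ⟫ *ₗ-assoc _ _ _ ⟫ ≈ᴹ-sym (e-· _ _ w ⟫ *ₗ-cong K.refl (e-· _ _ w)))
    (λ r → lift λ w → e-· _ _ w ⟫ *ₗ-cong K.refl (e-0 w) ⟫ *ₗ-zeroʳ _ ⟫ ≈ᴹ-sym (e-0 w))
    (λ r a b → lift λ w → e-· _ _ w ⟫ *ₗ-cong K.refl (e-+ _ _ w) ⟫ *ₗ-distribˡ _ _ _
                          ⟫ ≈ᴹ-sym (e-+ _ _ w ⟫ +ᴹ-cong (e-· _ _ w) (e-· _ _ w)))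

module _ {k ℓk : Level} {K : CommutativeRing k ℓk} {m ℓm : Level} where

  liftᴹ : ∀ ℓ′ → Module K m ℓm → Module K (m ⊔ ℓ′) (ℓ′ ⊔ ℓm)
  liftᴹ ℓ′ M = Induced.inducedModule K M ℓ′ {Y = ⊤} {X = Lift ℓ′ (Module.Carrierᴹ M)}
    (λ u v → lift (lower u +ᴹ lower v)) (lift 0ᴹ) (λ u → lift (-ᴹ lower u)) (λ r u → lift (r *ₗ lower u))
    (λ u _ → lower u) (λ _ _ _ → ≈ᴹ-refl) (λ _ → ≈ᴹ-refl) (λ _ _ → ≈ᴹ-refl) (λ _ _ _ → ≈ᴹ-refl)
    where open Module M

module _ {α αℓ k ℓk : Level} {A : CommutativeRing α αℓ} {K : CommutativeRing k ℓk}
         {π : CommutativeRing.Carrier A → CommutativeRing.Carrier K}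
         (π-hom : RingMorphisms.IsRingHomomorphism (CommutativeRing.rawRing A) (CommutativeRing.rawRing K) π)
         where
  open RingMorphisms.IsRingHomomorphism π-hom

  restrictScalars : ∀ {p ℓp} → Module K p ℓp → Module A p ℓp
  restrictScalars P = moduleFromLeft A _≈ᴹ_ _+ᴹ_ 0ᴹ -ᴹ_ (λ r x → π r *ₗ x)
    ≈ᴹ-isEquivalence +ᴹ-cong +ᴹ-assoc +ᴹ-comm +ᴹ-identityˡ -ᴹ‿cong -ᴹ‿inverseˡ
    (λ r≈s x≈y → *ₗ-cong (⟦⟧-cong r≈s) x≈y)
    (λ a → ≈ᴹ-trans (*ₗ-cong 0#-homo ≈ᴹ-refl) (*ₗ-zeroˡ a))
    (λ a r s → ≈ᴹ-trans (*ₗ-cong (+-homo r s) ≈ᴹ-refl) (*ₗ-distribʳ a _ _))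
    (λ a → ≈ᴹ-trans (*ₗ-cong 1#-homo ≈ᴹ-refl) (*ₗ-identityˡ a))
    (λ r s a → ≈ᴹ-trans (*ₗ-cong (*-homo r s) ≈ᴹ-refl) (*ₗ-assoc _ _ a))
    (λ r → *ₗ-zeroʳ _)
    (λ r a b → *ₗ-distribˡ _ a b)
    where open Module P

module Bilinear {α αℓ : Level} {A : CommutativeRing α αℓ} {m ℓm n ℓn p ℓp : Level}
  {M : Module A m ℓm} {N : Module A n ℓn} {P : Module A p ℓp}
  {b : Module.Carrierᴹ M → Module.Carrierᴹ N → Module.Carrierᴹ P}
  (b-bilinear : IsBilinear A M N P b) where
  private
    module A = CommutativeRing A
    module M = Module M
    module N = Module N
  open Module P
  open IsBilinear b-bilinear

  zeroˡ : ∀ y → b M.0ᴹ y ≈ᴹ 0ᴹ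
  zeroˡ y = ≈ᴹ-trans (cong (M.≈ᴹ-sym (M.*ₗ-zeroˡ M.0ᴹ)) N.≈ᴹ-refl)
                     (≈ᴹ-trans (*-homoˡ A.0# M.0ᴹ y) (*ₗ-zeroˡ _))

  zeroʳ : ∀ x → b x N.0ᴹ ≈ᴹ 0ᴹ
  zeroʳ x = ≈ᴹ-trans (cong M.≈ᴹ-refl (N.≈ᴹ-sym (N.*ₗ-zeroˡ N.0ᴹ)))
                     (≈ᴹ-trans (*-homoʳ A.0# x N.0ᴹ) (*ₗ-zeroˡ _))

  -ᴹ-homoˡ : ∀ x y → b (M.-ᴹ x) y ≈ᴹ -ᴹ b x y
  -ᴹ-homoˡ x y = GroupProperties.inverseˡ-unique +ᴹ-group _ _
    (≈ᴹ-trans (≈ᴹ-sym (+-homoˡ (M.-ᴹ x) x y)) (≈ᴹ-trans (cong (M.-ᴹ‿inverseˡ x) N.≈ᴹ-refl) (zeroˡ y)))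

  ∑-homoˡ : ∀ {z} {Z : Set z} (u : Z → M.Carrierᴹ) y ps →
            b (ListSum.∑ M.+ᴹ-abelianGroup u ps) y ≈ᴹ ListSum.∑ +ᴹ-abelianGroup (λ q → b (u q) y) ps
  ∑-homoˡ u y = ∑-homo M.+ᴹ-abelianGroup +ᴹ-abelianGroup (λ x → b x y) (λ x x′ → +-homoˡ x x′ y) (zeroˡ y) u

module _ {α αℓ : Level} {A : CommutativeRing α αℓ} {m ℓm n ℓn p ℓp : Level}
  {M : Module A m ℓm} {N : Module A n ℓn} {P : Module A p ℓp}
  {β : Module.Carrierᴹ M → Module.Carrierᴹ N → CommutativeRing.Carrier A} where
  private
    module A = CommutativeRing A
  open Module P

  *ₗ-bilinear : IsBilinear A M N (regular A) β → (q : Carrierᴹ) → IsBilinear A M N P (λ x y → β x y *ₗ q)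
  *ₗ-bilinear β-bilinear q = record
    { cong    = λ x≈x′ y≈y′ → *ₗ-cong (B.cong x≈x′ y≈y′) ≈ᴹ-refl
    ; +-homoˡ = λ x x′ y → ≈ᴹ-trans (*ₗ-cong (B.+-homoˡ x x′ y) ≈ᴹ-refl) (*ₗ-distribʳ q _ _)
    ; +-homoʳ = λ x y y′ → ≈ᴹ-trans (*ₗ-cong (B.+-homoʳ x y y′) ≈ᴹ-refl) (*ₗ-distribʳ q _ _)
    ; *-homoˡ = λ r x y → ≈ᴹ-trans (*ₗ-cong (B.*-homoˡ r x y) ≈ᴹ-refl) (*ₗ-assoc r _ q)
    ; *-homoʳ = λ r x y → ≈ᴹ-trans (*ₗ-cong (B.*-homoʳ r x y) ≈ᴹ-refl) (*ₗ-assoc r _ q) }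
    where module B = IsBilinear β-bilinear

module TensorUnitPairing {α αℓ m ℓm n ℓn : Level} {A : CommutativeRing α αℓ}
  {M : Module A m ℓm} {N : Module A n ℓn} (unit : TensorIsUnit A M N) where
  private
    module M = Module M
    module N = Module N
  open CommutativeRing A
  open ListSum +-abelianGroup
  open ListSum M.+ᴹ-abelianGroup using () renaming (∑ to ∑ᴹ; ∑-cong to ∑ᴹ-cong; ∑-ε to ∑ᴹ-ε)

  L : Level
  L = α ⊔ αℓ ⊔ m ⊔ ℓm ⊔ n ⊔ ℓn

  β : M.Carrierᴹ → N.Carrierᴹ → Carrier
  β = proj₁ unit

  β-bilinear : IsBilinear A M N (regular A) β
  β-bilinear = proj₁ (proj₂ unit)

  open Bilinear β-bilinear public using () renaming (-ᴹ-homoˡ to β-negˡ; ∑-homoˡ to β-∑ˡ)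

  module Factor (P : Module A L L) {b : M.Carrierᴹ → N.Carrierᴹ → Module.Carrierᴹ P}
                (b-bilinear : IsBilinear A M N P b) where
    open Module P

    factor : Carrier → Carrierᴹ
    factor = proj₁ (proj₂ (proj₂ unit) P b b-bilinear)

    factor-linear : IsLinear A (regular A) P factor
    factor-linear = proj₁ (proj₂ (proj₂ (proj₂ unit) P b b-bilinear))

    factor-β : ∀ x y → factor (β x y) ≈ᴹ b x y
    factor-β = proj₁ (proj₂ (proj₂ (proj₂ (proj₂ unit) P b b-bilinear)))

    factor-unique : (g : Carrier → Carrierᴹ) → IsLinear A (regular A) P g →
                    (∀ x y → g (β x y) ≈ᴹ b x y) → ∀ r → g r ≈ᴹ factor r
    factor-unique = proj₂ (proj₂ (proj₂ (proj₂ (proj₂ unit) P b b-bilinear)))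

  Pairs : Set (m ⊔ n)
  Pairs = M.Carrierᴹ × N.Carrierᴹ

  ∑β : List Pairs → Carrier
  ∑β = ∑ (λ (x , y) → β x y)

  negateLeft : List Pairs → List Pairs
  negateLeft = map (λ (x , y) → (M.-ᴹ x , y))

  scaleLeft : Carrier → List Pairs → List Pairs
  scaleLeft t = map (λ (x , y) → (t M.*ₗ x , y))

  ∑β-negate : ∀ ps → ∑β (negateLeft ps) ≈ - ∑β ps
  ∑β-negate ps = trans (∑-map _ _ ps) (trans (∑-cong (λ (x , y) → β-negˡ x y) ps)
    (sym (FormalCombination.-‿∑ A _ ps)))

  ∑β-scale : ∀ t ps → ∑β (scaleLeft t ps) ≈ t * ∑β ps
  ∑β-scale t ps = trans (∑-map _ _ ps) (trans (∑-cong (λ (x , y) → IsBilinear.*-homoˡ β-bilinear t x y) ps)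
    (sym (FormalCombination.*-∑ A t _ ps)))

  _∼_ : Carrier → Carrier → Set L
  r ∼ s = Lift L (Σ (List Pairs) λ ps → r - s ≈ ∑β ps)

  ≈⇒∼ : ∀ {r s} → r ≈ s → r ∼ s
  ≈⇒∼ {r} {s} r≈s = lift ([] , trans (+-cong r≈s refl) (-‿inverseʳ s))

  A/image : Module A L L
  A/image = moduleFromLeft A {X = Lift L Carrier} (λ u v → lower u ∼ lower v)
    (λ u v → lift (lower u + lower v)) (lift 0#) (λ u → lift (- lower u)) (λ r u → lift (r * lower u))
    (record { refl = ≈⇒∼ refl ; sym = ∼-sym ; trans = ∼-trans })
    ∼-+-cong
    (λ _ _ _ → ≈⇒∼ (+-assoc _ _ _))
    (λ _ _ → ≈⇒∼ (+-comm _ _))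
    (λ _ → ≈⇒∼ (+-identityˡ _))
    ∼-neg-cong
    (λ _ → ≈⇒∼ (-‿inverseˡ _))
    ∼-*-cong
    (λ _ → ≈⇒∼ (zeroˡ _))
    (λ _ _ _ → ≈⇒∼ (distribʳ _ _ _))
    (λ _ → ≈⇒∼ (*-identityˡ _))
    (λ _ _ _ → ≈⇒∼ (*-assoc _ _ _))
    (λ _ → ≈⇒∼ (zeroʳ _))
    (λ _ _ _ → ≈⇒∼ (distribˡ _ _ _))
    where
    open AbelianGroupProperties +-abelianGroup using (⁻¹-anti-homo‿-; ⁻¹-∙-comm)
    open CommutativeSemigroupProperties +-commutativeSemigroup using (interchange)
    open RingWithoutOneProperties (Ring.ringWithoutOne ring) using (x[y-z]≈xy-xz)

    ∼-sym : ∀ {r s} → r ∼ s → s ∼ r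
    ∼-sym {r} {s} (lift (ps , r-s≈)) =
      lift (negateLeft ps , trans (sym (⁻¹-anti-homo‿- r s)) (trans (-‿cong r-s≈) (sym (∑β-negate ps))))

    ∼-trans : ∀ {r s t} → r ∼ s → s ∼ t → r ∼ t
    ∼-trans {r} {s} {t} (lift (ps , r-s≈)) (lift (qs , s-t≈)) = lift (ps ++ qs , (begin
      r - t                  ≈⟨ +-cong (+-identityʳ r) refl ⟨
      (r + 0#) - t           ≈⟨ +-cong (+-cong refl (-‿inverseˡ s)) refl ⟨
      (r + (- s + s)) - t    ≈⟨ +-cong (+-assoc r (- s) s) refl ⟨
      ((r - s) + s) - t      ≈⟨ +-assoc (r - s) s (- t) ⟩
      (r - s) + (s - t)      ≈⟨ +-cong r-s≈ s-t≈ ⟩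
      ∑β ps + ∑β qs          ≈⟨ ∑-++ _ ps qs ⟨
      ∑β (ps ++ qs)          ∎))
      where open SetoidReasoning setoid

    ∼-+-cong : ∀ {r r′ s s′} → r ∼ r′ → s ∼ s′ → (r + s) ∼ (r′ + s′)
    ∼-+-cong {r} {r′} {s} {s′} (lift (ps , r≈)) (lift (qs , s≈)) = lift (ps ++ qs , (begin
      (r + s) - (r′ + s′)        ≈⟨ +-cong refl (⁻¹-∙-comm r′ s′) ⟨
      (r + s) + (- r′ + - s′)    ≈⟨ interchange r s (- r′) (- s′) ⟩
      (r - r′) + (s - s′)        ≈⟨ +-cong r≈ s≈ ⟩
      ∑β ps + ∑β qs              ≈⟨ ∑-++ _ ps qs ⟨
      ∑β (ps ++ qs)              ∎))
      where open SetoidReasoning setoid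

    ∼-neg-cong : ∀ {r s} → r ∼ s → (- r) ∼ (- s)
    ∼-neg-cong {r} {s} (lift (ps , r-s≈)) =
      lift (negateLeft ps , trans (⁻¹-∙-comm r (- s)) (trans (-‿cong r-s≈) (sym (∑β-negate ps))))

    ∼-*-cong : ∀ {t t′ r s} → t ≈ t′ → r ∼ s → (t * r) ∼ (t′ * s)
    ∼-*-cong {t} {t′} {r} {s} t≈t′ (lift (ps , r-s≈)) =
      lift (scaleLeft t ps , trans (+-cong refl (-‿cong (*-cong (sym t≈t′) refl)))
               (trans (sym (x[y-z]≈xy-xz t r s)) (trans (*-cong refl r-s≈) (sym (∑β-scale t ps)))))

  -- Only the stated properties of the witnesses below are ever used; keeping them opaque stops
  -- the conversion checker from unfolding the universal property inside them.
  opaque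
    one∈image : Σ (List Pairs) λ ps → 1# ≈ ∑β ps
    one∈image = ps , trans (sym (trans (+-cong refl (GroupProperties.ε⁻¹≈ε +-group)) (+-identityʳ 1#))) 1-0≈
      where
      [β]-bilinear : IsBilinear A M N A/image (λ x y → lift (β x y))
      [β]-bilinear = record
        { cong    = λ x≈x′ y≈y′ → ≈⇒∼ (IsBilinear.cong β-bilinear x≈x′ y≈y′)
        ; +-homoˡ = λ x x′ y → ≈⇒∼ (IsBilinear.+-homoˡ β-bilinear x x′ y)
        ; +-homoʳ = λ x y y′ → ≈⇒∼ (IsBilinear.+-homoʳ β-bilinear x y y′)
        ; *-homoˡ = λ r x y → ≈⇒∼ (IsBilinear.*-homoˡ β-bilinear r x y)
        ; *-homoʳ = λ r x y → ≈⇒∼ (IsBilinear.*-homoʳ β-bilinear r x y) }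
      open Factor A/image [β]-bilinear

      class : Carrier → Lift L Carrier
      class = lift

      class-linear : IsLinear A (regular A) A/image class
      class-linear = mkIsLinear A (regular A) A/image class ≈⇒∼ (λ _ _ → ≈⇒∼ refl) (λ _ _ → ≈⇒∼ refl)

      zero-map : Carrier → Lift L Carrier
      zero-map _ = lift 0#

      zero-linear : IsLinear A (regular A) A/image zero-map
      zero-linear = mkIsLinear A (regular A) A/image zero-map (λ _ → ≈⇒∼ refl)
        (λ _ _ → ≈⇒∼ (sym (+-identityˡ 0#))) (λ r _ → ≈⇒∼ (sym (zeroʳ r)))

      zero-β : ∀ x y → 0# ∼ β x y
      zero-β x y = lift ((M.-ᴹ x , y) ∷ [] ,
        trans (+-identityˡ _) (trans (sym (β-negˡ x y)) (sym (+-identityʳ _))))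

      1∼0 : 1# ∼ 0#
      1∼0 = Module.≈ᴹ-trans A/image (factor-unique class class-linear (λ _ _ → ≈⇒∼ refl) 1#)
              (Module.≈ᴹ-sym A/image (factor-unique zero-map zero-linear zero-β 1#))

      ps : List Pairs
      ps = proj₁ (1∼0 .lower)

      1-0≈ : 1# - 0# ≈ ∑β ps
      1-0≈ = proj₂ (1∼0 .lower)

  private
    M↑ : Module A L L
    M↑ = liftᴹ L M

    swap-bilinear : ∀ x′ → IsBilinear A M N M↑ (λ x y → lift (β x′ y M.*ₗ x))
    swap-bilinear x′ = record
      { cong    = λ x≈ y≈ → lift λ _ → M.*ₗ-cong (β.cong M.≈ᴹ-refl y≈) x≈
      ; +-homoˡ = λ x x″ y → lift λ _ → M.*ₗ-distribˡ _ x x″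
      ; +-homoʳ = λ x y y′ → lift λ _ →
          M.≈ᴹ-trans (M.*ₗ-cong (β.+-homoʳ x′ y y′) M.≈ᴹ-refl) (M.*ₗ-distribʳ x _ _)
      ; *-homoˡ = λ r x y → lift λ _ →
          M.≈ᴹ-trans (M.≈ᴹ-sym (M.*ₗ-assoc _ r x))
                     (M.≈ᴹ-trans (M.*ₗ-cong (*-comm _ r) M.≈ᴹ-refl) (M.*ₗ-assoc r _ x))
      ; *-homoʳ = λ r x y → lift λ _ →
          M.≈ᴹ-trans (M.*ₗ-cong (β.*-homoʳ r x′ y) M.≈ᴹ-refl) (M.*ₗ-assoc r _ x) }
      where module β = IsBilinear β-bilinear

  opaque
    swap : M.Carrierᴹ → M.Carrierᴹ
    swap x′ = lower (Factor.factor M↑ (swap-bilinear x′) 1#)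

    β-swap : ∀ x′ x y → β x y M.*ₗ swap x′ M.≈ᴹ β x′ y M.*ₗ x
    β-swap x′ x y = lower (Module.≈ᴹ-trans M↑ (Module.≈ᴹ-sym M↑ (linear-regular A M↑ factor-linear (β x y)))
                                              (factor-β x y)) _
      where open Factor M↑ (swap-bilinear x′)

  -- (swap xₖ , β (-) yₖ) for (xₖ , yₖ) ∈ basis is a finite dual basis of M.
  basis : List Pairs
  basis = proj₁ one∈image

  opaque
    fromCoefficients : (N.Carrierᴹ → Carrier) → M.Carrierᴹ
    fromCoefficients c = ∑ᴹ (λ (x′ , y′) → c y′ M.*ₗ swap x′) basis

    dualBasis : ∀ x → x M.≈ᴹ fromCoefficients (β x)
    dualBasis x = M.≈ᴹ-sym (begin
      ∑ᴹ (λ (x′ , y′) → β x y′ M.*ₗ swap x′) basis  ≈⟨ ∑ᴹ-cong (λ (x′ , y′) → β-swap x′ x y′) basis ⟩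
      ∑ᴹ (λ (x′ , y′) → β x′ y′ M.*ₗ x) basis        ≈⟨ ∑-*ₗ basis ⟨
      ∑β basis M.*ₗ x                                ≈⟨ M.*ₗ-cong (proj₂ one∈image) M.≈ᴹ-refl ⟨
      1# M.*ₗ x                                      ≈⟨ M.*ₗ-identityˡ x ⟩
      x                                              ∎)
      where
      open SetoidReasoning M.≈ᴹ-setoid
      ∑-*ₗ : ∀ ps → ∑β ps M.*ₗ x M.≈ᴹ ∑ᴹ (λ (x′ , y′) → β x′ y′ M.*ₗ x) ps
      ∑-*ₗ = ∑-homo +-abelianGroup M.+ᴹ-abelianGroup (M._*ₗ x) (λ r s → M.*ₗ-distribʳ x r s) (M.*ₗ-zeroˡ x) _

    fromCoefficients-0 : ∀ c → (∀ y → c y ≈ 0#) → fromCoefficients c M.≈ᴹ M.0ᴹ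
    fromCoefficients-0 c c≈0 = M.≈ᴹ-trans
      (∑ᴹ-cong (λ (x′ , y′) → M.≈ᴹ-trans (M.*ₗ-cong (c≈0 y′) M.≈ᴹ-refl) (M.*ₗ-zeroˡ _)) basis) (∑ᴹ-ε basis)

    β-fromCoefficients : ∀ c y → β (fromCoefficients c) y ≈ ∑ (λ (x′ , y′) → c y′ * β (swap x′) y) basis
    β-fromCoefficients c y =
      trans (β-∑ˡ _ y basis) (∑-cong (λ (x′ , y′) → IsBilinear.*-homoˡ β-bilinear (c y′) (swap x′) y) basis)

  β-dualBasis : ∀ x y → β x y ≈ ∑ (λ (x′ , y′) → β x y′ * β (swap x′) y) basis
  β-dualBasis x y = trans (IsBilinear.cong β-bilinear (dualBasis x) N.≈ᴹ-refl) (β-fromCoefficients (β x) y)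

  β-injectiveˡ : ∀ {x x′} → (∀ y → β x y ≈ β x′ y) → x M.≈ᴹ x′
  β-injectiveˡ {x} {x′} βx≈βx′ = GroupProperties.x∙y⁻¹≈ε⇒x≈y M.+ᴹ-group x x′
    (M.≈ᴹ-trans (dualBasis _) (fromCoefficients-0 _ β-vanishes))
    where
    β-vanishes : ∀ y → β (x M.+ᴹ M.-ᴹ x′) y ≈ 0#
    β-vanishes y = trans (IsBilinear.+-homoˡ β-bilinear x (M.-ᴹ x′) y)
      (trans (+-cong (βx≈βx′ y) (β-negˡ x′ y)) (-‿inverseʳ _))

-- K ⊗_A M is modelled by formal K-combinations of elements of M, identified when they induce
-- the same functional N → K through π ∘ β.  A must live at least as high as K: the universal
-- property of β only covers A-modules at its own level, and it is applied to K-modules with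
-- scalars restricted along π.
module BaseChange {k ℓk α αℓ m ℓm n ℓn : Level}
  {K : CommutativeRing k ℓk} {A : CommutativeRing (k ⊔ α) (ℓk ⊔ αℓ)}
  {π : CommutativeRing.Carrier A → CommutativeRing.Carrier K}
  (π-hom : RingMorphisms.IsRingHomomorphism (CommutativeRing.rawRing A) (CommutativeRing.rawRing K) π)
  {M : Module A m ℓm} {N : Module A n ℓn} (unit : TensorIsUnit A M N) where
  private
    module A = CommutativeRing A
    module M = Module M
    module N = Module N
    module π = RingMorphisms.IsRingHomomorphism π-hom
  open CommutativeRing K
  open FormalCombination K
  open TensorUnitPairing unit
  private
    module β = IsBilinear β-bilinear

  module Side {x ℓx y : Level} (X : Module A x ℓx) {Y : Set y}
    (γ : Module.Carrierᴹ X → Y → A.Carrier)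
    (γ-cong : ∀ {x x′} → Module._≈ᴹ_ X x x′ → ∀ w → γ x w A.≈ γ x′ w)
    (γ-+ : ∀ x x′ w → γ (Module._+ᴹ_ X x x′) w A.≈ γ x w A.+ γ x′ w)
    (γ-* : ∀ r x w → γ (Module._*ₗ_ X r x) w A.≈ r A.* γ x w) where
    private
      module X = Module X

    pairing : List (Carrier × X.Carrierᴹ) → Y → Carrier
    pairing u w = evaluate (λ x → π (γ x w)) u

    Xₖ : Module K (k ⊔ x) (L ⊔ y ⊔ ℓk)
    Xₖ = Induced.inducedModule K (regular K) L _++_ [] negateCoeffs scaleCoeffs pairing
      (λ u v w → evaluate-++ _ u v) (λ _ → refl) (λ u w → evaluate-negateCoeffs _ u)
      (λ t u w → evaluate-scaleCoeffs t _ u)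

    open Module Xₖ using () renaming (_≈ᴹ_ to _≈ₖ_)

    ι : X.Carrierᴹ → List (Carrier × X.Carrierᴹ)
    ι x = (1# , x) ∷ []

    pairing-ι : ∀ x w → pairing (ι x) w ≈ π (γ x w)
    pairing-ι x w = trans (+-identityʳ _) (*-identityˡ _)

    private
      ι-≈ : ∀ {x} v → (∀ w → π (γ x w) ≈ pairing v w) → ι x ≈ₖ v
      ι-≈ {x} v eq = lift λ w → trans (pairing-ι x w) (eq w)

    ι-cong : ∀ {x x′} → x X.≈ᴹ x′ → ι x ≈ₖ ι x′
    ι-cong {x′ = x′} x≈x′ = ι-≈ (ι x′) λ w → trans (π.⟦⟧-cong (γ-cong x≈x′ w)) (sym (pairing-ι x′ w))

    ι-+ : ∀ x x′ → ι (x X.+ᴹ x′) ≈ₖ ι x ++ ι x′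
    ι-+ x x′ = ι-≈ (ι x ++ ι x′) λ w → trans (π.⟦⟧-cong (γ-+ x x′ w))
      (trans (π.+-homo _ _) (sym (+-cong (*-identityˡ _) (pairing-ι x′ w))))

    ι-* : ∀ r x → ι (r X.*ₗ x) ≈ₖ scaleCoeffs (π r) (ι x)
    ι-* r x = ι-≈ (scaleCoeffs (π r) (ι x)) λ w → trans (π.⟦⟧-cong (γ-* r x w))
      (trans (π.*-homo _ _) (sym (trans (+-identityʳ _) (*-cong (*-identityʳ _) refl))))

    singleton≈ : ∀ r x → ((r , x) ∷ []) ≈ₖ scaleCoeffs r (ι x)
    singleton≈ r x = lift λ w → +-cong (*-cong (sym (*-identityʳ r)) refl) refl

  module ᴹ = Side M β (λ x≈x′ y → β.cong x≈x′ N.≈ᴹ-refl) (λ x x′ y → β.+-homoˡ x x′ y)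
                     (λ r x y → β.*-homoˡ r x y)
  module ᴺ = Side N (flip β) (λ y≈y′ x → β.cong M.≈ᴹ-refl y≈y′) (λ y y′ x → β.+-homoʳ x y y′)
                     (λ r y x → β.*-homoʳ r x y)

  Mₖ : Module K (k ⊔ m) L
  Mₖ = ᴹ.Xₖ

  Nₖ : Module K (k ⊔ n) L
  Nₖ = ᴺ.Xₖ

  βₖ : List (Carrier × M.Carrierᴹ) → List (Carrier × N.Carrierᴹ) → Carrier
  βₖ u v = evaluate (ᴹ.pairing u) v

  βₖ-comm : ∀ u v → βₖ u v ≈ evaluate (ᴺ.pairing v) u
  βₖ-comm u v = sym (evaluate-comm (λ x y → π (β x y)) u v)

  βₖ-bilinear : IsBilinear K Mₖ Nₖ (regular K) βₖ
  βₖ-bilinear = record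
    { cong    = λ {u} {u′} {v} {v′} u≈u′ v≈v′ → trans (evaluate-cong (lower u≈u′) v)
                  (trans (βₖ-comm u′ v) (trans (evaluate-cong (lower v≈v′) u′) (sym (βₖ-comm u′ v′))))
    ; +-homoˡ = λ u u′ v → trans (evaluate-cong (λ y → evaluate-++ _ u u′) v) (evaluate-+ _ _ v)
    ; +-homoʳ = λ u v v′ → evaluate-++ _ v v′
    ; *-homoˡ = λ t u v → trans (evaluate-cong (λ y → evaluate-scaleCoeffs t _ u) v) (evaluate-* t _ v)
    ; *-homoʳ = λ t u v → evaluate-scaleCoeffs t _ v }

  βₖ-singleton : ∀ r x s y → βₖ ((r , x) ∷ []) ((s , y) ∷ []) ≈ r * (s * π (β x y))
  βₖ-singleton r x s y = trans (+-identityʳ _) (trans (*-cong refl (+-identityʳ _)) (x∙yz≈y∙xz s r _))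
    where open CommutativeSemigroupProperties *-commutativeSemigroup using (x∙yz≈y∙xz)

  βₖ-ι : ∀ x y → βₖ (ᴹ.ι x) (ᴺ.ι y) ≈ π (β x y)
  βₖ-ι x y = trans (βₖ-singleton 1# x 1# y) (trans (*-identityˡ _) (*-identityˡ _))

  module _ {p ℓp : Level} (P : Module K p ℓp)
    {b b′ : List (Carrier × M.Carrierᴹ) → List (Carrier × N.Carrierᴹ) → Module.Carrierᴹ P}
    (b-bilinear : IsBilinear K Mₖ Nₖ P b) (b′-bilinear : IsBilinear K Mₖ Nₖ P b′) where
    open Module P
    private
      module b = IsBilinear b-bilinear
      module b′ = IsBilinear b′-bilinear

    bilinear-ext : (∀ r x s y → b ((r , x) ∷ []) ((s , y) ∷ []) ≈ᴹ b′ ((r , x) ∷ []) ((s , y) ∷ [])) →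
                   ∀ u v → b u v ≈ᴹ b′ u v
    bilinear-ext agree []      v =
      ≈ᴹ-trans (Bilinear.zeroˡ b-bilinear v) (≈ᴹ-sym (Bilinear.zeroˡ b′-bilinear v))
    bilinear-ext agree (q ∷ u) v = ≈ᴹ-trans (b.+-homoˡ (q ∷ []) u v)
      (≈ᴹ-trans (+ᴹ-cong (on-singleton q v) (bilinear-ext agree u v)) (≈ᴹ-sym (b′.+-homoˡ (q ∷ []) u v)))
      where
      on-singleton : ∀ q v → b (q ∷ []) v ≈ᴹ b′ (q ∷ []) v
      on-singleton q       []      =
        ≈ᴹ-trans (Bilinear.zeroʳ b-bilinear _) (≈ᴹ-sym (Bilinear.zeroʳ b′-bilinear _))
      on-singleton (r , x) (q′ ∷ v) = ≈ᴹ-trans (b.+-homoʳ _ (q′ ∷ []) v)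
        (≈ᴹ-trans (+ᴹ-cong (agree r x (proj₁ q′) (proj₂ q′)) (on-singleton (r , x) v))
                  (≈ᴹ-sym (b′.+-homoʳ _ (q′ ∷ []) v)))

  module Factorization (P : Module K L L)
    {b : List (Carrier × M.Carrierᴹ) → List (Carrier × N.Carrierᴹ) → Module.Carrierᴹ P}
    (b-bilinear : IsBilinear K Mₖ Nₖ P b) where
    open Module P
    private
      module b = IsBilinear b-bilinear

    P↓ : Module A L L
    P↓ = restrictScalars π-hom P

    b↓-bilinear : IsBilinear A M N P↓ (λ x y → b (ᴹ.ι x) (ᴺ.ι y))
    b↓-bilinear = record
      { cong    = λ x≈x′ y≈y′ → b.cong (ᴹ.ι-cong x≈x′) (ᴺ.ι-cong y≈y′)
      ; +-homoˡ = λ x x′ y → ≈ᴹ-trans (b.cong (ᴹ.ι-+ x x′) (Module.≈ᴹ-refl Nₖ {ᴺ.ι y})) (b.+-homoˡ _ _ _)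
      ; +-homoʳ = λ x y y′ → ≈ᴹ-trans (b.cong (Module.≈ᴹ-refl Mₖ {ᴹ.ι x}) (ᴺ.ι-+ y y′)) (b.+-homoʳ _ _ _)
      ; *-homoˡ = λ r x y → ≈ᴹ-trans (b.cong (ᴹ.ι-* r x) (Module.≈ᴹ-refl Nₖ {ᴺ.ι y})) (b.*-homoˡ _ _ _)
      ; *-homoʳ = λ r x y → ≈ᴹ-trans (b.cong (Module.≈ᴹ-refl Mₖ {ᴹ.ι x}) (ᴺ.ι-* r y)) (b.*-homoʳ _ _ _) }

    open Factor P↓ b↓-bilinear

    p₀ : Carrierᴹ
    p₀ = factor A.1#

    b-ι : ∀ x y → b (ᴹ.ι x) (ᴺ.ι y) ≈ᴹ π (β x y) *ₗ p₀
    b-ι x y = ≈ᴹ-trans (≈ᴹ-sym (factor-β x y)) (linear-regular A P↓ factor-linear (β x y))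

    b≈βₖ*ₗp₀ : ∀ u v → b u v ≈ᴹ βₖ u v *ₗ p₀
    b≈βₖ*ₗp₀ = bilinear-ext P b-bilinear (*ₗ-bilinear βₖ-bilinear p₀) λ r x s y → begin
      b ((r , x) ∷ []) ((s , y) ∷ [])
        ≈⟨ b.cong (ᴹ.singleton≈ r x) (ᴺ.singleton≈ s y) ⟩
      b (scaleCoeffs r (ᴹ.ι x)) (scaleCoeffs s (ᴺ.ι y))   ≈⟨ b.*-homoˡ r _ _ ⟩
      r *ₗ b (ᴹ.ι x) (scaleCoeffs s (ᴺ.ι y))              ≈⟨ *ₗ-cong refl (b.*-homoʳ s _ _) ⟩
      r *ₗ (s *ₗ b (ᴹ.ι x) (ᴺ.ι y))                       ≈⟨ *ₗ-cong refl (*ₗ-cong refl (b-ι x y)) ⟩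
      r *ₗ (s *ₗ (π (β x y) *ₗ p₀))                       ≈⟨ *ₗ-cong refl (*ₗ-assoc s _ p₀) ⟨
      r *ₗ ((s * π (β x y)) *ₗ p₀)                        ≈⟨ *ₗ-assoc r _ p₀ ⟨
      (r * (s * π (β x y))) *ₗ p₀                         ≈⟨ *ₗ-cong (βₖ-singleton r x s y) ≈ᴹ-refl ⟨
      βₖ ((r , x) ∷ []) ((s , y) ∷ []) *ₗ p₀              ∎
      where open SetoidReasoning ≈ᴹ-setoid

    scale : Carrier → Carrierᴹ
    scale r = r *ₗ p₀

    scale-linear : IsLinear K (regular K) P scale
    scale-linear = mkIsLinear K (regular K) P scale (λ r≈s → *ₗ-cong r≈s ≈ᴹ-refl)
      (λ r s → *ₗ-distribʳ p₀ r s) (λ r s → *ₗ-assoc r s p₀)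

    scale-unique : (g : Carrier → Carrierᴹ) → IsLinear K (regular K) P g →
                   (∀ u v → g (βₖ u v) ≈ᴹ b u v) → ∀ r → g r ≈ᴹ scale r
    scale-unique g g-linear gβₖ r = ≈ᴹ-trans (linear-regular K P g-linear r) (*ₗ-cong refl g1≈p₀)
      where
      module g = ModuleMorphisms.IsModuleHomomorphism g-linear

      g∘π-linear : IsLinear A (regular A) P↓ (g ∘ π)
      g∘π-linear = mkIsLinear A (regular A) P↓ (g ∘ π) (λ a≈b → g.⟦⟧-cong (π.⟦⟧-cong a≈b))
        (λ a b → ≈ᴹ-trans (g.⟦⟧-cong (π.+-homo a b)) (g.+ᴹ-homo (π a) (π b)))
        (λ a b → ≈ᴹ-trans (g.⟦⟧-cong (π.*-homo a b)) (g.*ₗ-homo (π a) (π b)))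

      g1≈p₀ : g 1# ≈ᴹ p₀
      g1≈p₀ = ≈ᴹ-trans (g.⟦⟧-cong (sym π.1#-homo))
        (factor-unique (g ∘ π) g∘π-linear (λ x y → ≈ᴹ-trans (g.⟦⟧-cong (sym (βₖ-ι x y))) (gβₖ _ _)) A.1#)

  tensorIsUnit : TensorIsUnit K Mₖ Nₖ
  tensorIsUnit = βₖ , βₖ-bilinear , λ P b b-bilinear → let open Factorization P b-bilinear in
    scale , scale-linear , (λ u v → Module.≈ᴹ-sym P (b≈βₖ*ₗp₀ u v)) , scale-unique

  private
    π-∑ : ∀ {z} {Z : Set z} (f : Z → A.Carrier) ps →
          π (ListSum.∑ A.+-abelianGroup f ps) ≈ ∑ (π ∘ f) ps
    π-∑ = ∑-homo A.+-abelianGroup +-abelianGroup π π.+-homo π.0#-homo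

    πβ-dualBasis : ∀ x y → π (β x y) ≈ ∑ (λ (x′ , y′) → π (β x y′) * π (β (swap x′) y)) basis
    πβ-dualBasis x y = trans (π.⟦⟧-cong (β-dualBasis x y))
      (trans (π-∑ _ basis) (∑-cong (λ (x′ , y′) → π.*-homo _ _) basis))

  pairing-dualBasis : ∀ u y → ᴹ.pairing u y ≈ ∑ (λ (x′ , y′) → ᴹ.pairing u y′ * π (β (swap x′) y)) basis
  pairing-dualBasis u y = trans (evaluate-cong (λ x → πβ-dualBasis x y) u)
    (evaluate-∑ (λ x (x′ , y′) → π (β x y′)) (λ (x′ , y′) → π (β (swap x′) y)) u basis)

  ι-lift : (c : N.Carrierᴹ → A.Carrier) (u : List (Carrier × M.Carrierᴹ)) →
           (∀ y → π (c y) ≈ ᴹ.pairing u y) → Module._≈ᴹ_ Mₖ (ᴹ.ι (fromCoefficients c)) u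
  ι-lift c u πc≈ = lift λ y → begin
    ᴹ.pairing (ᴹ.ι (fromCoefficients c)) y                      ≈⟨ ᴹ.pairing-ι _ y ⟩
    π (β (fromCoefficients c) y)                                ≈⟨ π.⟦⟧-cong (β-fromCoefficients c y) ⟩
    π (ListSum.∑ A.+-abelianGroup (λ (x′ , y′) → c y′ A.* β (swap x′) y) basis)  ≈⟨ π-∑ _ basis ⟩
    ∑ (λ (x′ , y′) → π (c y′ A.* β (swap x′) y)) basis
      ≈⟨ ∑-cong (λ (x′ , y′) → trans (π.*-homo _ _) (*-cong (πc≈ y′) refl)) basis ⟩
    ∑ (λ (x′ , y′) → ᴹ.pairing u y′ * π (β (swap x′) y)) basis  ≈⟨ pairing-dualBasis u y ⟨
    ᴹ.pairing u y                                               ∎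
    where open SetoidReasoning setoid

  ι-reflects : ∀ {x x′} → Module._≈ᴹ_ Mₖ (ᴹ.ι x) (ᴹ.ι x′) → ∀ y → π (β x y) ≈ π (β x′ y)
  ι-reflects {x} {x′} ιx≈ιx′ y = trans (sym (ᴹ.pairing-ι x y)) (trans (lower ιx≈ιx′ y) (ᴹ.pairing-ι x′ y))

module _ {a c ℓ : Level} {I : Set a} (R : I → CommutativeRing c ℓ) where

  proj-isRingHomomorphism : (i : I) →
    RingMorphisms.IsRingHomomorphism (CommutativeRing.rawRing (ΠRing I R)) (CommutativeRing.rawRing (R i))
                                     (λ f → f i)
  proj-isRingHomomorphism i = record
    { isSemiringHomomorphism = record
      { isNearSemiringHomomorphism = record
        { +-isMonoidHomomorphism = record
          { isMagmaHomomorphism = record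
            { isRelHomomorphism = record { cong = λ f≈g → f≈g i }
            ; homo = λ _ _ → refl }
          ; ε-homo = refl }
        ; *-homo = λ _ _ → refl }
      ; 1#-homo = refl }
    ; -‿homo = λ _ → refl }
    where open CommutativeRing (R i) using (refl)

module PicTrivialProduct {a c ℓ : Level} (I : Set a) (R : I → CommutativeRing c ℓ)
  (picTrivial : (i : I) → PicTrivial (R i))
  {m ℓm n ℓn : Level} {M : Module (ΠRing I R) m ℓm} {N : Module (ΠRing I R) n ℓn}
  (unit : TensorIsUnit (ΠRing I R) M N) where
  private
    module A = CommutativeRing (ΠRing I R)
    module M = Module M
    module R i = CommutativeRing (R i)
  open TensorUnitPairing unit
  module Bᵢ (i : I) = BaseChange {α = a} {αℓ = a} {K = R i} {A = ΠRing I R} (proj-isRingHomomorphism R i) unit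

  iso : ∀ i → _≅ᴹ_ (R i) (Bᵢ.Mₖ i) (regular (R i))
  iso i = picTrivial i (Bᵢ.Mₖ i) (Bᵢ.Nₖ i) (Bᵢ.tensorIsUnit i)

  φ : ∀ i → List (R.Carrier i × M.Carrierᴹ) → R.Carrier i
  φ i = proj₁ (iso i)

  module φ (i : I) = ModuleMorphisms.IsModuleIsomorphism (proj₂ (iso i))

  generator : ∀ i → List (R.Carrier i × M.Carrierᴹ)
  generator i = proj₁ (φ.surjective i (R.1# i))

  φ-generator : ∀ i → R._≈_ i (φ i (generator i)) (R.1# i)
  φ-generator i = proj₂ (φ.surjective i (R.1# i)) (Module.≈ᴹ-refl (Bᵢ.Mₖ i) {generator i})

  -- The only use of the product structure: the factorwise coefficients of the generators
  -- form a single element of Π R, and so glue to one element of M.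
  coefficient : Module.Carrierᴹ N → A.Carrier
  coefficient y i = Bᵢ.ᴹ.pairing i (generator i) y

  opaque
    x₀ : M.Carrierᴹ
    x₀ = fromCoefficients coefficient

    ι-x₀ : ∀ i → Module._≈ᴹ_ (Bᵢ.Mₖ i) (Bᵢ.ᴹ.ι i x₀) (generator i)
    ι-x₀ i = Bᵢ.ι-lift i coefficient (generator i) (λ y → R.refl i)

  F : M.Carrierᴹ → A.Carrier
  F x i = φ i (Bᵢ.ᴹ.ι i x)

  F-linear : IsLinear (ΠRing I R) M (regular (ΠRing I R)) F
  F-linear = mkIsLinear (ΠRing I R) M (regular (ΠRing I R)) F
    (λ x≈x′ i → φ.⟦⟧-cong i (Bᵢ.ᴹ.ι-cong i x≈x′))
    (λ x x′ i → R.trans i (φ.⟦⟧-cong i (Bᵢ.ᴹ.ι-+ i x x′)) (φ.+ᴹ-homo i _ _))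
    (λ r x i → R.trans i (φ.⟦⟧-cong i (Bᵢ.ᴹ.ι-* i r x)) (φ.*ₗ-homo i (r i) _))

  F-injective : ∀ {x x′} → F x A.≈ F x′ → x M.≈ᴹ x′
  F-injective Fx≈Fx′ = β-injectiveˡ λ y i → Bᵢ.ι-reflects i (φ.injective i (Fx≈Fx′ i)) y

  F-*ₗx₀ : ∀ g → F (g M.*ₗ x₀) A.≈ g
  F-*ₗx₀ g i = begin
    φ i (Bᵢ.ᴹ.ι i (g M.*ₗ x₀))                        ≈⟨ φ.⟦⟧-cong i (Bᵢ.ᴹ.ι-* i g x₀) ⟩
    φ i (Module._*ₗ_ (Bᵢ.Mₖ i) (g i) (Bᵢ.ᴹ.ι i x₀))  ≈⟨ φ.*ₗ-homo i (g i) _ ⟩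
    R._*_ i (g i) (φ i (Bᵢ.ᴹ.ι i x₀))                 ≈⟨ R.*-cong i (R.refl i) (φ.⟦⟧-cong i (ι-x₀ i)) ⟩
    R._*_ i (g i) (φ i (generator i))                 ≈⟨ R.*-cong i (R.refl i) (φ-generator i) ⟩
    R._*_ i (g i) (R.1# i)                            ≈⟨ R.*-identityʳ i (g i) ⟩
    g i                                               ∎
    where open SetoidReasoning (R.setoid i)

  F-surjective : ∀ g → Σ M.Carrierᴹ λ x → ∀ {z} → z M.≈ᴹ x → F z A.≈ g
  F-surjective g = g M.*ₗ x₀ , λ z≈gx₀ → A.trans (λ i → φ.⟦⟧-cong i (Bᵢ.ᴹ.ι-cong i z≈gx₀)) (F-*ₗx₀ g)

  M≅A : _≅ᴹ_ (ΠRing I R) M (regular (ΠRing I R))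
  M≅A = F , record
    { isModuleMonomorphism = record { isModuleHomomorphism = F-linear ; injective = F-injective }
    ; surjective = F-surjective }

mainTheorem11 : {a c ℓ : Level} (I : Set a) (R : I → CommutativeRing c ℓ) →
                ((i : I) → PicTrivial (R i)) →
                PicTrivial (ΠRing I R)
mainTheorem11 I R picTrivial M N unit = PicTrivialProduct.M≅A I R picTrivial unit
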